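{- Let $(T,\eta,\mu)$ be the perfect matching monad on $\mathbf{Graph}$ described below. Then the Eilenberg–Moore category $\mathbf{Graph}^T$ of algebras for $T$ is isomorphic to the category $\mathbf{Perf}$ of perfect matchings.
   Context: $\mathbf{Graph}$ is the category whose objects are simple, loopless, undirected graphs (the vertex set may be empty or infinite; edges are $2$-element sets of vertices) and whose morphisms are graph homomorphisms (maps on vertices sending adjacent vertices to adjacent vertices). For a graph $A$, $T(A)$ has vertex set $V(A)\times\{0,1\}$ (write $x_i$ for $(x,i)$) and edges exactly $\{x_0,y_0\}$ for $\{x,y\}\in E(A)$ and $\{x_0,x_1\}$ for $x\in V(A)$; for a homomorphism $f$, $T(f)(x_i)=f(x)_i$; $\eta_A(x)=x_0$; $\mu_A:T(T(A))\to T(A)$ is $\mu_A((x_i)_j)=x_{i\oplus j}$ with $\oplus$ addition mod $2$. This is a monad. An algebra for $T$ is a pair $(A,\alpha)$ with $\alpha:T(A)\to A$ a graph homomorphism such that $\alpha\circ\eta_A=\mathrm{id}_A$ and $\alpha\circ T(\alpha)=\alpha\circ\mu_A$; a morphism of algebras $h:(A_1,\alpha_1)\to(A_2,\alpha_2)$ is a graph homomorphism $h:A_1\to A_2$ with $h\circ\alpha_1=\alpha_2\circ T(h)$; these form the category $\mathbf{Graph}^T$. A perfect matching on a graph $A$ is a map $m:V(A)\to V(A)$ such that $\{x,m(x)\}\in E(A)$ for all $x\in V(A)$ and $m\circ m=\mathrm{id}_{V(A)}$. $\mathbf{Perf}$ has as objects pairs $(A,m)$ with $m$ a perfect matching on the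 graph $A$, and as morphisms $f:(A,m)\to(B,m')$ the graph homomorphisms $f:A\to B$ with $f(m(x))=m'(f(x))$ for all $x\in V(A)$. -}

module Defs where

open import Data.Bool using (Bool; true; false; _xor_; not)
open import Data.Empty using (⊥)
open import Data.Product using (Σ; _×_; _,_; proj₁; proj₂)
open import Relation.Binary.PropositionalEquality
  using (_≡_; refl; sym; trans; cong; subst)

record Graph : Set₁ where
  field
    V      : Set
    E      : V → V → Set
    E-sym  : ∀ {x y} → E x y → E y x
    E-irr  : ∀ {x} → E x x → ⊥
open Graph public

record GHom (A B : Graph) : Set where
  field
    fun  : V A → V B
    pres : ∀ {x y} → E A x y → E B (fun x) (fun y)
open GHom public

_≈_ : ∀ {A B} → GHom A B → GHom A B → Set
f ≈ g = ∀ x → fun f x ≡ fun g x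

idG : ∀ A → GHom A A
idG A = record { fun = λ x → x ; pres = λ e → e }

_∘G_ : ∀ {A B C} → GHom B C → GHom A B → GHom A C
g ∘G f = record { fun = λ x → fun g (fun f x) ; pres = λ e → pres g (pres f e) }

-- The perfect matching monad T.  x_i is written (x , i) with 0 = false.

TE : (A : Graph) → V A × Bool → V A × Bool → Set
TE A (x , false) (y , false) = E A x y
TE A (x , false) (y , true)  = x ≡ y
TE A (x , true)  (y , false) = x ≡ y
TE A (x , true)  (y , true)  = ⊥

TE-sym : ∀ A {u v} → TE A u v → TE A v u
TE-sym A {x , false} {y , false} e = E-sym A e
TE-sym A {x , false} {y , true}  e = sym e
TE-sym A {x , true}  {y , false} e = sym e
TE-sym A {x , true}  {y , true}  ()

TE-irr : ∀ A {u} → TE A u u → ⊥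
TE-irr A {x , false} e = E-irr A e
TE-irr A {x , true}  ()

T : Graph → Graph
T A = record { V = V A × Bool ; E = TE A ; E-sym = λ {u} {v} → TE-sym A {u} {v} ; E-irr = λ {u} → TE-irr A {u} }

Tpres : ∀ {A B} (f : GHom A B) {u v} → TE A u v →
        TE B (fun f (proj₁ u) , proj₂ u) (fun f (proj₁ v) , proj₂ v)
Tpres f {x , false} {y , false} e = pres f e
Tpres f {x , false} {y , true}  e = cong (fun f) e
Tpres f {x , true}  {y , false} e = cong (fun f) e
Tpres f {x , true}  {y , true}  ()

Tmap : ∀ {A B} → GHom A B → GHom (T A) (T B)
Tmap f = record { fun = λ u → (fun f (proj₁ u) , proj₂ u) ; pres = λ {u} {v} → Tpres f {u} {v} }

η : ∀ A → GHom A (T A)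
η A = record { fun = λ x → (x , false) ; pres = λ e → e }

μfun : ∀ A → V (T (T A)) → V (T A)
μfun A ((x , i) , j) = (x , i xor j)

μpres : ∀ A {u v} → E (T (T A)) u v → E (T A) (μfun A u) (μfun A v)
μpres A {(x , false) , false} {(y , false) , false} e = e
μpres A {(x , false) , false} {(y , true)  , false} e = e
μpres A {(x , true)  , false} {(y , false) , false} e = e
μpres A {(x , true)  , false} {(y , true)  , false} ()
μpres A {(x , false) , false} {(y , false) , true} refl = refl
μpres A {(x , true)  , false} {(y , true)  , true} refl = refl
μpres A {(x , false) , true}  {(y , false) , false} refl = refl
μpres A {(x , true)  , true}  {(y , true)  , false} refl = refl
μpres A {(x , false) , true}  {(y , true)  , true}  ()
μpres A {(x , false) , true}  {(y , false) , true}  ()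
μpres A {(x , true)  , true}  {(y , false) , true}  ()
μpres A {(x , true)  , true}  {(y , true)  , true}  ()

μ : ∀ A → GHom (T (T A)) (T A)
μ A = record { fun = μfun A ; pres = λ {u} {v} → μpres A {u} {v} }

record Alg : Set₁ where
  field
    carrier : Graph
    α       : GHom (T carrier) carrier
    unit    : ∀ x → fun α (fun (η carrier) x) ≡ x
    assoc   : ∀ z → fun α (fun (Tmap α) z) ≡ fun α (fun (μ carrier) z)
open Alg public

record AlgHom (X Y : Alg) : Set where
  field
    ahom    : GHom (carrier X) (carrier Y)
    commute : ∀ z → fun ahom (fun (α X) z) ≡ fun (α Y) (fun (Tmap ahom) z)
open AlgHom public

idAlg : ∀ X → AlgHom X X
idAlg X = record { ahom = idG (carrier X) ; commute = λ z → refl }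

_∘A_ : ∀ {X Y Z} → AlgHom Y Z → AlgHom X Y → AlgHom X Z
_∘A_ g h = record
  { ahom    = ahom g ∘G ahom h
  ; commute = λ z → trans (cong (fun (ahom g)) (commute h z))
                          (commute g (fun (Tmap (ahom h)) z)) }

record PerfectMatching (A : Graph) : Set where
  field
    m     : V A → V A
    adj   : ∀ x → E A x (m x)
    invol : ∀ x → m (m x) ≡ x
open PerfectMatching public

record PerfObj : Set₁ where
  field
    graph    : Graph
    matching : PerfectMatching graph
open PerfObj public

record PerfHom (X Y : PerfObj) : Set where
  field
    phom     : GHom (graph X) (graph Y)
    preserve : ∀ x → fun phom (m (matching X) x) ≡ m (matching Y) (fun phom x)
open PerfHom public

idPerf : ∀ X → PerfHom X X
idPerf X = record { phom = idG (graph X) ; preserve = λ x → refl }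

_∘P_ : ∀ {X Y Z} → PerfHom Y Z → PerfHom X Y → PerfHom X Z
_∘P_ g h = record
  { phom     = phom g ∘G phom h
  ; preserve = λ x → trans (cong (fun (phom g)) (preserve h x))
                           (preserve g (fun (phom h) x)) }

coe : ∀ {A B : Graph} → A ≡ B → V A → V B
coe p = subst V p

coeT : ∀ {A B : Graph} → A ≡ B → V (T A) → V (T B)
coeT p u = (coe p (proj₁ u) , proj₂ u)

AlgEq : Alg → Alg → Set₁
AlgEq X Y = Σ (carrier X ≡ carrier Y) λ p →
              ∀ z → fun (α Y) (coeT p z) ≡ coe p (fun (α X) z)

PerfEq : PerfObj → PerfObj → Set₁
PerfEq X Y = Σ (graph X ≡ graph Y) λ p →
               ∀ x → m (matching Y) (coe p x) ≡ coe p (m (matching X) x)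

HomHEq : ∀ {A A' B B'} → A ≡ A' → B ≡ B' → GHom A B → GHom A' B' → Set
HomHEq p q f g = ∀ x → fun g (coe p x) ≡ coe q (fun f x)

record GraphT≅Perf : Set₁ where
  field
    F₀     : Alg → PerfObj
    F₁     : ∀ {X Y} → AlgHom X Y → PerfHom (F₀ X) (F₀ Y)
    F-resp : ∀ {X Y} {h k : AlgHom X Y} → ahom h ≈ ahom k → phom (F₁ h) ≈ phom (F₁ k)
    F-id   : ∀ X → phom (F₁ (idAlg X)) ≈ phom (idPerf (F₀ X))
    F-∘    : ∀ {X Y Z} (g : AlgHom Y Z) (h : AlgHom X Y) →
             phom (F₁ (g ∘A h)) ≈ phom (F₁ g ∘P F₁ h)

    G₀     : PerfObj → Alg
    G₁     : ∀ {X Y} → PerfHom X Y → AlgHom (G₀ X) (G₀ Y)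
    G-resp : ∀ {X Y} {h k : PerfHom X Y} → phom h ≈ phom k → ahom (G₁ h) ≈ ahom (G₁ k)
    G-id   : ∀ X → ahom (G₁ (idPerf X)) ≈ ahom (idAlg (G₀ X))
    G-∘    : ∀ {X Y Z} (g : PerfHom Y Z) (h : PerfHom X Y) →
             ahom (G₁ (g ∘P h)) ≈ ahom (G₁ g ∘A G₁ h)

    GF₀    : ∀ X → AlgEq (G₀ (F₀ X)) X
    FG₀    : ∀ Y → PerfEq (F₀ (G₀ Y)) Y
    GF₁    : ∀ {X Y} (h : AlgHom X Y) →
             HomHEq (proj₁ (GF₀ X)) (proj₁ (GF₀ Y)) (ahom (G₁ (F₁ h))) (ahom h)
    FG₁    : ∀ {X Y} (h : PerfHom X Y) →
             HomHEq (proj₁ (FG₀ X)) (proj₁ (FG₀ Y)) (phom (F₁ (G₁ h))) (phom h)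

-- An algebra structure α : T A → A is determined by its value on the
-- layer V(A) × {1}: the unit law forces α(x₀) = x, so α(x₁) is the only
-- freedom.  Preservation of the edge x₀ — x₁ makes x ↦ α(x₁) adjacent to
-- x, and associativity at (x₁)₁ (where μ gives x₀) makes it an
-- involution; conversely a perfect matching m defines α(x₀) = x,
-- α(x₁) = m x.  Both constructions leave the graph and the underlying
-- vertex maps of morphisms untouched, so they are mutually inverse on the
-- nose.
module Submission where

open import Defs
open import Data.Bool using (Bool; true; false)
open import Data.Product using (_,_; _×_)
open import Relation.Binary.PropositionalEquality using (_≡_; refl; trans; subst)

algebraMatching : (X : Alg) → PerfectMatching (carrier X)
algebraMatching X = record
  { m     = λ x → fun (α X) (x , true)
  ; adj   = λ x → subst (λ w → E (carrier X) w (fun (α X) (x , true))) (unit X x)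
                        (pres (α X) {x , false} {x , true} refl)
  ; invol = λ x → trans (assoc X ((x , true) , true)) (unit X x)
  }

algebra→perfect : Alg → PerfObj
algebra→perfect X = record { graph = carrier X ; matching = algebraMatching X }

algebraHom→perfectHom : ∀ {X Y} → AlgHom X Y →
                        PerfHom (algebra→perfect X) (algebra→perfect Y)
algebraHom→perfectHom h = record { phom = ahom h ; preserve = λ x → commute h (x , true) }

module _ {A : Graph} (M : PerfectMatching A) where

  matchingAction : V A × Bool → V A
  matchingAction (x , false) = x
  matchingAction (x , true)  = m M x

  matchingAction-pres : ∀ {u v} → TE A u v → E A (matchingAction u) (matchingAction v)
  matchingAction-pres {x , false} {y , false} e    = e
  matchingAction-pres {x , false} {y , true}  refl = adj M x
  matchingAction-pres {x , true}  {y , false} refl = E-sym A (adj M x)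
  matchingAction-pres {x , true}  {y , true}  ()

  matchingAlgebraMap : GHom (T A) A
  matchingAlgebraMap = record
    { fun  = matchingAction
    ; pres = λ {u} {v} → matchingAction-pres {u} {v} }

  matchingAction-assoc : ∀ z → matchingAction (fun (Tmap matchingAlgebraMap) z)
                             ≡ matchingAction (μfun A z)
  matchingAction-assoc ((x , false) , false) = refl
  matchingAction-assoc ((x , false) , true)  = refl
  matchingAction-assoc ((x , true)  , false) = refl
  matchingAction-assoc ((x , true)  , true)  = invol M x

perfect→algebra : PerfObj → Alg
perfect→algebra Y = record
  { carrier = graph Y
  ; α       = matchingAlgebraMap (matching Y)
  ; unit    = λ x → refl
  ; assoc   = matchingAction-assoc (matching Y)
  }

perfectHom→algebraHom : ∀ {X Y} → PerfHom X Y →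
                        AlgHom (perfect→algebra X) (perfect→algebra Y)
perfectHom→algebraHom {X} {Y} h = record { ahom = phom h ; commute = commutes }
  where
  commutes : ∀ z → fun (phom h) (matchingAction (matching X) z)
                 ≡ matchingAction (matching Y) (fun (Tmap (phom h)) z)
  commutes (x , false) = refl
  commutes (x , true)  = preserve h x

algebraAction-determined : (X : Alg) (z : V (T (carrier X))) →
                           fun (α X) z ≡ matchingAction (algebraMatching X) z
algebraAction-determined X (x , false) = unit X x
algebraAction-determined X (x , true)  = refl

mainTheorem2 : GraphT≅Perf
mainTheorem2 = record
  { F₀     = algebra→perfect
  ; F₁     = algebraHom→perfectHom
  ; F-resp = λ p → p
  ; F-id   = λ X x → refl
  ; F-∘    = λ g h x → refl
  ; G₀     = perfect→algebra
  ; G₁     = perfectHom→algebraHom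
  ; G-resp = λ p → p
  ; G-id   = λ X x → refl
  ; G-∘    = λ g h x → refl
  ; GF₀    = λ X → refl , algebraAction-determined X
  ; FG₀    = λ Y → refl , λ x → refl
  ; GF₁    = λ h x → refl
  ; FG₁    = λ h x → refl
  }
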